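{- Let $(x,y,z,m,n)$ be a nontrivial solution in positive integers with $x>y$ of $\phi\left(z\frac{x^m-y^m}{x-y}\right)=z\frac{x^n-y^n}{x-y}$ such that $x\le 80$, $1\le z\le x-y$ and $\gcd(m,n)=1$. Let $d_1=\gcd(x,y)$, $x_1=x/d_1$, $y_1=y/d_1$. If $q$ is a prime factor of $m$ and $k$ is a positive integer such that $q^k\nmid x_1^{q-1}-y_1^{q-1}$, then there are at most $k$ distinct odd primes $p\nmid x_1y_1$ with $\ell_p\mid m$ and $q\mid\ell_p$.
   Context: $\phi$ is Euler's totient function. A solution $(x,y,z,m,n)$ of this equation in positive integers with $x>y$ is trivial if it equals $(a,b,1,1,1)$ for integers $a>b\ge1$; otherwise nontrivial. For an odd prime $p$ with $p\nmid x_1y_1$, $\ell_p$ denotes the least positive integer $\ell$ such that $p\mid x_1^\ell-y_1^\ell$. -}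

module Defs where

open import Data.Nat using (ℕ; zero; suc; _+_; _*_; _∸_; _^_; _≤_; _<_; _/_)
open import Data.Nat.GCD using (gcd)
open import Data.Nat.Divisibility using (_∣_)
open import Data.List using (List; []; _∷_; length; filter; upTo; map)
open import Data.Product using (_×_; ∃)
open import Relation.Nullary using (¬_)
open import Relation.Binary.PropositionalEquality using (_≡_)
open import Data.Nat using (_≟_)

_÷_ : ℕ → ℕ → ℕ
a ÷ zero = 0
a ÷ suc b = a / suc b

φ : ℕ → ℕ
φ n = length (filter (λ k → gcd k n ≟ 1) (map suc (upTo n)))

-- IsOrd a b p ℓ : ℓ is the least positive integer with p ∣ a^ℓ - b^ℓ
-- (this is ℓ_p when a = x₁, b = y₁).
IsOrd : ℕ → ℕ → ℕ → ℕ → Set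
IsOrd a b p ℓ =
  0 < ℓ × p ∣ (a ^ ℓ ∸ b ^ ℓ) × (∀ j → 0 < j → j < ℓ → ¬ (p ∣ (a ^ j ∸ b ^ j)))

-- Write x = g a, y = g b with gcd a b = 1, and G t = (aᵗ − bᵗ)/(a − b); the equation becomes
-- φ(z g^(m−1) G m) = z g^(n−1) G n.  As φ N ≤ N and G is increasing, n ≤ m, so c = z g^(n−1)
-- divides N = z g^(m−1) G m.  Every counted prime p divides G m (because ℓ_p ∣ m and ℓ_p > 1) and
-- satisfies q ∣ ℓ_p ∣ p − 1 by Fermat, so it contributes one factor q to φ N, on top of the
-- q^(v_q(c) − 1) coming from the q-part of N.  Comparing with φ N = c · G n leaves q^(s−1) ∣ G n,
-- where s is the number of counted primes.  Finally q ∤ n: with d = gcd(n, q − 1) we have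
-- aᵈ ≡ bᵈ (mod q) and (aⁿ − bⁿ)/(aᵈ − bᵈ) ≡ (n/d) a^(n−d) ≢ 0 (mod q), so
-- q^(s−1) ∣ aᵈ − bᵈ ∣ a^(q−1) − b^(q−1), which forces s − 1 < k.
module Submission where

open import Defs
open import Data.Bool using (Bool; true; false; if_then_else_; _∧_; not)
open import Data.Bool.Properties using (∧-zeroʳ; ∧-identityʳ)
open import Data.List using (List; []; _∷_; length; filter; map; applyUpTo)
open import Data.List.Relation.Unary.All using (All; []; _∷_)
import Data.List.Relation.Unary.All as All
open import Data.List.Relation.Unary.AllPairs using ([]; _∷_)
open import Data.List.Relation.Unary.Unique.Propositional using (Unique)
open import Data.Nat
open import Data.Nat.Combinatorics
open import Data.Nat.Coprimality
  using (Coprime; coprime-divisor; coprime⇒gcd≡1; gcd≡1⇒coprime; coprime-/gcd)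
import Data.Nat.Coprimality as Coprimality
open import Data.Nat.Divisibility
open import Data.Nat.DivMod hiding (_mod_)
open import Data.Nat.GCD
  using (gcd; GCD; module Bézout; gcd-GCD; gcd[m,n]∣m; gcd[m,n]∣n; gcd-greatest; gcd[m,n]≢0)
open import Data.Nat.Induction using (<-rec)
open import Data.Nat.Primality
open import Data.Nat.Properties
open import Algebra.Properties.CommutativeSemigroup *-commutativeSemigroup using (x∙yz≈y∙xz)
open import Data.Nat.Tactic.RingSolver using (solve-∀)
open import Data.Product using (_×_; _,_; ∃; ∃₂)
open import Data.Sum using (inj₁; inj₂)
open import Function using (id; _∘_; _$_; _⇔_; mk⇔; Equivalence)
open import Induction.WellFounded using (WfRec)
open import Relation.Binary.PropositionalEquality
open import Relation.Nullary using (¬_; contradiction; yes; no)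
open import Relation.Nullary.Decidable using (does; does-⇔; dec-true; dec-false)
open import Relation.Unary using (Decidable)

open ≡-Reasoning

^-monoʳ-∣ : ∀ c {u w} → u ≤ w → c ^ u ∣ c ^ w
^-monoʳ-∣ c {u} {w} u≤w = divides (c ^ (w ∸ u)) (begin
  c ^ w               ≡⟨ cong (c ^_) (m+[n∸m]≡n u≤w) ⟨
  c ^ (u + (w ∸ u))   ≡⟨ ^-distribˡ-+-* c u (w ∸ u) ⟩
  c ^ u * c ^ (w ∸ u) ≡⟨ *-comm (c ^ u) _ ⟩
  c ^ (w ∸ u) * c ^ u ∎)

[m*n]^t≡m^t*n^t : ∀ m n t → (m * n) ^ t ≡ m ^ t * n ^ t
[m*n]^t≡m^t*n^t m n zero    = refl
[m*n]^t≡m^t*n^t m n (suc t) = begin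
  m * n * (m * n) ^ t        ≡⟨ cong (m * n *_) ([m*n]^t≡m^t*n^t m n t) ⟩
  m * n * (m ^ t * n ^ t)    ≡⟨ [m*n]*[o*p]≡[m*o]*[n*p] m n (m ^ t) (n ^ t) ⟩
  m * m ^ t * (n * n ^ t)    ∎

0^n≡0 : ∀ n .{{_ : NonZero n}} → 0 ^ n ≡ 0
0^n≡0 (suc n) = refl

a*a^[n∸1]≡a^n : ∀ a n .{{_ : NonZero n}} → a * a ^ (n ∸ 1) ≡ a ^ n
a*a^[n∸1]≡a^n a (suc n) = refl

n∤n∸1 : ∀ n .{{_ : NonTrivial n}} → ¬ n ∣ n ∸ 1
n∤n∸1 (suc (suc n)) n∣n∸1 = <⇒≱ (n<1+n (suc n)) (∣⇒≤ n∣n∸1)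

m+n≤1+n+[m∸1] : ∀ m n → m + n ≤ suc n + (m ∸ 1)
m+n≤1+n+[m∸1] zero    n = ≤-trans (n≤1+n n) (≤-reflexive (sym (+-identityʳ (suc n))))
m+n≤1+n+[m∸1] (suc m) n = ≤-reflexive (cong suc (+-comm m n))

m÷n≡m/n : ∀ m n .{{_ : NonZero n}} → m ÷ n ≡ m / n
m÷n≡m/n m (suc n) = refl

m*n÷n≡m : ∀ m n .{{_ : NonZero n}} → (m * n) ÷ n ≡ m
m*n÷n≡m m (suc n) = m*n/n≡m m (suc n)

n∣n! : ∀ n .{{_ : NonZero n}} → n ∣ n !
n∣n! (suc n) = m∣m*n (n !)

nCk*k![n∸k]!≡n! : ∀ {n k} → k ≤ n → (n C k) * (k ! * (n ∸ k) !) ≡ n !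
nCk*k![n∸k]!≡n! {n} {k} k≤n = begin
  (n C k) * (k ! * (n ∸ k) !)                 ≡⟨ cong (_* (k ! * (n ∸ k) !)) (nCk≡n!/k![n-k]! k≤n) ⟩
  n ! / (k ! * (n ∸ k) !) * (k ! * (n ∸ k) !) ≡⟨ m/n*n≡m (k![n∸k]!∣n! k≤n) ⟩
  n !                                         ∎
  where
  instance
    k!*[n∸k]!≢0 : NonZero (k ! * (n ∸ k) !)
    k!*[n∸k]!≢0 = k !* (n ∸ k) !≢0

-- Congruences

infix 4 _≡_mod_
_≡_mod_ : ℕ → ℕ → (r : ℕ) → .{{NonZero r}} → Set
_≡_mod_ a b r = a % r ≡ b % r

module _ {r : ℕ} .{{_ : NonZero r}} where

  +-cong-mod : ∀ {a b c d} → a ≡ b mod r → c ≡ d mod r → a + c ≡ b + d mod r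
  +-cong-mod {a} {b} {c} {d} a≡b c≡d = begin
    (a + c) % r         ≡⟨ %-distribˡ-+ a c r ⟩
    (a % r + c % r) % r ≡⟨ cong₂ (λ u v → (u + v) % r) a≡b c≡d ⟩
    (b % r + d % r) % r ≡⟨ %-distribˡ-+ b d r ⟨
    (b + d) % r         ∎

  *-cong-mod : ∀ {a b c d} → a ≡ b mod r → c ≡ d mod r → a * c ≡ b * d mod r
  *-cong-mod {a} {b} {c} {d} a≡b c≡d = begin
    (a * c) % r           ≡⟨ %-distribˡ-* a c r ⟩
    (a % r * (c % r)) % r ≡⟨ cong₂ (λ u v → (u * v) % r) a≡b c≡d ⟩
    (b % r * (d % r)) % r ≡⟨ %-distribˡ-* b d r ⟨
    (b * d) % r           ∎

  ∣⇒≡0-mod : ∀ {a} → r ∣ a → a ≡ 0 mod r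
  ∣⇒≡0-mod {a} r∣a = trans (n∣m⇒m%n≡0 a r r∣a) (sym (n∣m⇒m%n≡0 0 r (r ∣0)))

  ≡0-mod⇒∣ : ∀ {a} → a ≡ 0 mod r → r ∣ a
  ≡0-mod⇒∣ {a} a≡0 = m%n≡0⇒n∣m a r (trans a≡0 (n∣m⇒m%n≡0 0 r (r ∣0)))

  ∣∸⇒≡-mod : ∀ {a b} → b ≤ a → r ∣ a ∸ b → a ≡ b mod r
  ∣∸⇒≡-mod {a} {b} b≤a r∣a∸b = begin
    a % r           ≡⟨ cong (_% r) (m∸n+n≡m b≤a) ⟨
    (a ∸ b + b) % r ≡⟨ %-remove-+ˡ b r∣a∸b ⟩
    b % r           ∎

  ≡-mod⇒∣∸ : ∀ {a b} → a ≡ b mod r → r ∣ a ∸ b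
  ≡-mod⇒∣∸ {a} {b} a≡b = divides (a / r ∸ b / r) (begin
    a ∸ b                                   ≡⟨ cong₂ _∸_ (m≡m%n+[m/n]*n a r) (m≡m%n+[m/n]*n b r) ⟩
    a % r + a / r * r ∸ (b % r + b / r * r) ≡⟨ cong (λ c → a % r + a / r * r ∸ (c + b / r * r)) a≡b ⟨
    a % r + a / r * r ∸ (a % r + b / r * r) ≡⟨ [m+n]∸[m+o]≡n∸o (a % r) _ _ ⟩
    a / r * r ∸ b / r * r                   ≡⟨ *-distribʳ-∸ r (a / r) (b / r) ⟨
    (a / r ∸ b / r) * r                     ∎)

module _ {p : ℕ} (p-prime : Prime p) where

  private instance
    p≢0 : NonZero p
    p≢0 = prime⇒nonZero p-prime

  prime⇒∤1 : ¬ p ∣ 1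
  prime⇒∤1 p∣1 = nonTrivial⇒≢1 {{prime⇒nonTrivial p-prime}} (∣1⇒≡1 p∣1)

  prime∣^⇒∣ : ∀ {a} t → p ∣ a ^ t → p ∣ a
  prime∣^⇒∣ zero        p∣1       = contradiction p∣1 prime⇒∤1
  prime∣^⇒∣ {a} (suc t) p∣a^[1+t] with euclidsLemma a (a ^ t) p-prime p∣a^[1+t]
  ... | inj₁ p∣a   = p∣a
  ... | inj₂ p∣a^t = prime∣^⇒∣ t p∣a^t

  ∣prime⇒≡ : ∀ {d} → Prime d → d ∣ p → d ≡ p
  ∣prime⇒≡ d-prime d∣p with prime⇒irreducible p-prime d∣p
  ... | inj₁ refl = contradiction d-prime ¬prime[1]
  ... | inj₂ d≡p  = d≡p

  ∣*∸*⇒∣∸ : ∀ {c a b} → ¬ p ∣ c → p ∣ c * a ∸ c * b → p ∣ a ∸ b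
  ∣*∸*⇒∣∸ {c} {a} {b} p∤c p∣ca∸cb
    with euclidsLemma c (a ∸ b) p-prime (subst (p ∣_) (sym (*-distribˡ-∸ c a b)) p∣ca∸cb)
  ... | inj₁ p∣c   = contradiction p∣c p∤c
  ... | inj₂ p∣a∸b = p∣a∸b

  *-cancelˡ-mod : ∀ {c a b} → ¬ p ∣ c → c * a ≡ c * b mod p → a ≡ b mod p
  *-cancelˡ-mod {c} {a} {b} p∤c ca≡cb with ≤-total b a
  ... | inj₁ b≤a = ∣∸⇒≡-mod b≤a (∣*∸*⇒∣∸ p∤c (≡-mod⇒∣∸ ca≡cb))
  ... | inj₂ a≤b = sym (∣∸⇒≡-mod a≤b (∣*∸*⇒∣∸ p∤c (≡-mod⇒∣∸ (sym ca≡cb))))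

  ^∣*-cancelʳ : ∀ j {w v} → ¬ p ∣ v → p ^ j ∣ w * v → p ^ j ∣ w
  ^∣*-cancelʳ zero    _ _ = 1∣ _
  ^∣*-cancelʳ (suc j) {w} {v} p∤v p^[1+j]∣wv
    with euclidsLemma w v p-prime (∣-trans (m∣m*n (p ^ j)) p^[1+j]∣wv)
  ... | inj₂ p∣v               = contradiction p∣v p∤v
  ... | inj₁ (divides w′ refl) = subst (p ^ suc j ∣_) (*-comm p w′) (*-monoʳ-∣ p p^j∣w′)
    where
    w′pv≡p[w′v] : w′ * p * v ≡ p * (w′ * v)
    w′pv≡p[w′v] = trans (cong (_* v) (*-comm w′ p)) (*-assoc p w′ v)
    p^j∣w′ : p ^ j ∣ w′
    p^j∣w′ = ^∣*-cancelʳ j p∤v (*-cancelˡ-∣ p (subst (p ^ suc j ∣_) w′pv≡p[w′v] p^[1+j]∣wv))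

-- Geometric sums

geomSum : ℕ → ℕ → ℕ → ℕ
geomSum zero    a b = 0
geomSum (suc t) a b = a ^ t + b * geomSum t a b

b^t+d*geomSum≡[b+d]^t : ∀ t b d → b ^ t + d * geomSum t (b + d) b ≡ (b + d) ^ t
b^t+d*geomSum≡[b+d]^t zero    b d = cong suc (*-zeroʳ d)
b^t+d*geomSum≡[b+d]^t (suc t) b d = begin
  b * b ^ t + d * ((b + d) ^ t + b * G)     ≡⟨ cong (λ c → b * b ^ t + d * (c + b * G)) induction ⟨
  b * b ^ t + d * ((b ^ t + d * G) + b * G) ≡⟨ regroup b d (b ^ t) G ⟩
  (b + d) * (b ^ t + d * G)                 ≡⟨ cong ((b + d) *_) induction ⟩
  (b + d) * (b + d) ^ t                     ∎
  where
  G : ℕ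
  G = geomSum t (b + d) b
  induction : b ^ t + d * G ≡ (b + d) ^ t
  induction = b^t+d*geomSum≡[b+d]^t t b d
  regroup : ∀ b d c g → b * c + d * ((c + d * g) + b * g) ≡ (b + d) * (c + d * g)
  regroup = solve-∀

^∸^≡[∸]*geomSum : ∀ t {a b} → b ≤ a → a ^ t ∸ b ^ t ≡ (a ∸ b) * geomSum t a b
^∸^≡[∸]*geomSum t {a} {b} b≤a = begin
  a ^ t ∸ b ^ t                           ≡⟨ cong (_∸ b ^ t) b^t+[a∸b]G≡a^t ⟨
  b ^ t + (a ∸ b) * geomSum t a b ∸ b ^ t ≡⟨ m+n∸m≡n (b ^ t) _ ⟩
  (a ∸ b) * geomSum t a b                 ∎
  where
  b^t+[a∸b]G≡a^t : b ^ t + (a ∸ b) * geomSum t a b ≡ a ^ t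
  b^t+[a∸b]G≡a^t = subst (λ c → b ^ t + (a ∸ b) * geomSum t c b ≡ c ^ t) (m+[n∸m]≡n b≤a)
                         (b^t+d*geomSum≡[b+d]^t t b (a ∸ b))

^[t*d]∸^[t*d]≡[^d∸^d]*geomSum : ∀ t d {a b} → b ≤ a →
  a ^ (t * d) ∸ b ^ (t * d) ≡ (a ^ d ∸ b ^ d) * geomSum t (a ^ d) (b ^ d)
^[t*d]∸^[t*d]≡[^d∸^d]*geomSum t d {a} {b} b≤a = begin
  a ^ (t * d) ∸ b ^ (t * d)                   ≡⟨ cong₂ _∸_ (^[t*d]≡[^d]^t a) (^[t*d]≡[^d]^t b) ⟩
  (a ^ d) ^ t ∸ (b ^ d) ^ t                   ≡⟨ ^∸^≡[∸]*geomSum t (^-monoˡ-≤ d b≤a) ⟩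
  (a ^ d ∸ b ^ d) * geomSum t (a ^ d) (b ^ d) ∎
  where
  ^[t*d]≡[^d]^t : ∀ c → c ^ (t * d) ≡ (c ^ d) ^ t
  ^[t*d]≡[^d]^t c = trans (cong (c ^_) (*-comm t d)) (sym (^-*-assoc c d t))

^∸^-mono-∣ : ∀ {d e a b} → d ∣ e → b ≤ a → a ^ d ∸ b ^ d ∣ a ^ e ∸ b ^ e
^∸^-mono-∣ {d} {a = a} {b} (divides t refl) b≤a =
  subst (a ^ d ∸ b ^ d ∣_) (sym (^[t*d]∸^[t*d]≡[^d∸^d]*geomSum t d b≤a)) (m∣m*n _)

geomSum-cong-mod : ∀ {r} .{{_ : NonZero r}} {a b} t → a ≡ b mod r →
  geomSum t a b ≡ t * a ^ (t ∸ 1) mod r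
geomSum-cong-mod zero    a≡b = refl
geomSum-cong-mod {r} {a} {b} (suc t) a≡b = begin
  (a ^ t + b * geomSum t a b) % r     ≡⟨ +-cong-mod {b = a ^ t} refl (*-cong-mod (sym a≡b) (geomSum-cong-mod t a≡b)) ⟩
  (a ^ t + a * (t * a ^ (t ∸ 1))) % r ≡⟨ cong (λ c → (a ^ t + c) % r) (a*[t*a^[t∸1]]≡t*a^t t) ⟩
  (a ^ t + t * a ^ t) % r             ∎
  where
  a*[t*a^[t∸1]]≡t*a^t : ∀ t → a * (t * a ^ (t ∸ 1)) ≡ t * a ^ t
  a*[t*a^[t∸1]]≡t*a^t zero    = *-zeroʳ a
  a*[t*a^[t∸1]]≡t*a^t (suc t) = x∙yz≈y∙xz a (suc t) (a ^ t)

geomSum>0 : ∀ t {a} b → 0 < a → 0 < t → 0 < geomSum t a b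
geomSum>0 (suc t) {a} b 0<a _ = <-≤-trans (m^n>0 a {{>-nonZero 0<a}} t) (m≤m+n (a ^ t) _)

geomSum<geomSum[1+t] : ∀ t {a b} → 0 < a → 0 < b → geomSum t a b < geomSum (suc t) a b
geomSum<geomSum[1+t] t {a} {b} 0<a 0<b =
  <-≤-trans (+-monoˡ-< (geomSum t a b) (m^n>0 a {{>-nonZero 0<a}} t))
            (+-monoʳ-≤ (a ^ t) (m≤n*m (geomSum t a b) b {{>-nonZero 0<b}}))

geomSum-monoˡ-< : ∀ {s t a b} → 0 < a → 0 < b → s < t → geomSum s a b < geomSum t a b
geomSum-monoˡ-< {s} {suc t} 0<a 0<b s<1+t with m<1+n⇒m<n∨m≡n s<1+t
... | inj₁ s<t  = <-trans (geomSum-monoˡ-< 0<a 0<b s<t) (geomSum<geomSum[1+t] t 0<a 0<b)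
... | inj₂ refl = geomSum<geomSum[1+t] t 0<a 0<b

-- Fermat's little theorem

binomialSum : ℕ → ℕ → ℕ → ℕ
binomialSum n a zero    = 0
binomialSum n a (suc j) = binomialSum n a j + (n C j) * a ^ j

binomialSum-pascal : ∀ n a j →
  binomialSum (suc n) a (suc j) ≡ binomialSum n a (suc j) + a * binomialSum n a j
binomialSum-pascal n a zero    = cong suc (sym (*-zeroʳ a))
binomialSum-pascal n a (suc j) = begin
  binomialSum (suc n) a (suc j) + (suc n C suc j) * (a * a ^ j)
    ≡⟨ cong₂ (λ s c → s + c * (a * a ^ j)) (binomialSum-pascal n a j) (sym (nCk+nC[k+1]≡[n+1]C[k+1] n j)) ⟩
  (B + (n C j) * a ^ j + a * B) + ((n C j) + (n C suc j)) * (a * a ^ j)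
    ≡⟨ regroup B (n C j) (n C suc j) a (a ^ j) ⟩
  (B + (n C j) * a ^ j + (n C suc j) * (a * a ^ j)) + a * (B + (n C j) * a ^ j)
    ∎
  where
  B : ℕ
  B = binomialSum n a j
  regroup : ∀ B c c′ a x →
    (B + c * x + a * B) + (c + c′) * (a * x) ≡ (B + c * x + c′ * (a * x)) + a * (B + c * x)
  regroup = solve-∀

[1+a]^n≡binomialSum : ∀ n a → suc a ^ n ≡ binomialSum n a (suc n)
[1+a]^n≡binomialSum zero    a = refl
[1+a]^n≡binomialSum (suc n) a = begin
  suc a * suc a ^ n                                           ≡⟨ cong (suc a *_) ([1+a]^n≡binomialSum n a) ⟩
  binomialSum n a (suc n) + a * binomialSum n a (suc n)       ≡⟨ cong (_+ a * binomialSum n a (suc n)) last-term-vanishes ⟨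
  binomialSum n a (suc (suc n)) + a * binomialSum n a (suc n) ≡⟨ binomialSum-pascal n a (suc n) ⟨
  binomialSum (suc n) a (suc (suc n))                         ∎
  where
  last-term-vanishes : binomialSum n a (suc (suc n)) ≡ binomialSum n a (suc n)
  last-term-vanishes = trans (cong (λ c → binomialSum n a (suc n) + c * a ^ suc n) (k>n⇒nCk≡0 (n<1+n n)))
                             (+-identityʳ _)

module _ {p : ℕ} (p-prime : Prime p) where

  private instance
    p≢0 : NonZero p
    p≢0 = prime⇒nonZero p-prime

  prime∤! : ∀ {j} → j < p → ¬ p ∣ j !
  prime∤! {zero}  _   = prime⇒∤1 p-prime
  prime∤! {suc j} j<p p∣[1+j]! with euclidsLemma (suc j) (j !) p-prime p∣[1+j]!
  ... | inj₁ p∣1+j = <⇒≱ j<p (∣⇒≤ p∣1+j)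
  ... | inj₂ p∣j!  = prime∤! (<-trans (n<1+n j) j<p) p∣j!

  prime∣pCk : ∀ {k} → 0 < k → k < p → p ∣ p C k
  prime∣pCk {k} 0<k k<p with euclidsLemma (p C k) (k ! * (p ∸ k) !) p-prime p∣pCk*k!*[p∸k]!
    where
    p∣pCk*k!*[p∸k]! : p ∣ (p C k) * (k ! * (p ∸ k) !)
    p∣pCk*k!*[p∸k]! = subst (p ∣_) (sym (nCk*k![n∸k]!≡n! (<⇒≤ k<p))) (n∣n! p)
  ... | inj₁ p∣pCk = p∣pCk
  ... | inj₂ p∣k!*[p∸k]! with euclidsLemma (k !) ((p ∸ k) !) p-prime p∣k!*[p∸k]!
  ...   | inj₁ p∣k!     = contradiction p∣k! (prime∤! k<p)
  ...   | inj₂ p∣[p∸k]! = contradiction p∣[p∸k]! (prime∤! (∸-monoʳ-< 0<k (<⇒≤ k<p)))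

  binomialSum≡1-mod : ∀ a {j} → 0 < j → j ≤ p → binomialSum p a j ≡ 1 mod p
  binomialSum≡1-mod a {suc zero}    _ _     = refl
  binomialSum≡1-mod a {suc (suc j)} _ 2+j≤p =
    +-cong-mod {d = 0} (binomialSum≡1-mod a (s≤s z≤n) (<⇒≤ 2+j≤p))
                       (∣⇒≡0-mod (∣m⇒∣m*n (a ^ suc j) (prime∣pCk (s≤s z≤n) 2+j≤p)))

  fermat : ∀ a → a ^ p ≡ a mod p
  fermat zero    = cong (_% p) (0^n≡0 p)
  fermat (suc a) = begin
    suc a ^ p % p                             ≡⟨ cong (_% p) ([1+a]^n≡binomialSum p a) ⟩
    (binomialSum p a p + (p C p) * a ^ p) % p ≡⟨ cong (λ c → (binomialSum p a p + c * a ^ p) % p) (nCn≡1 p) ⟩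
    (binomialSum p a p + 1 * a ^ p) % p       ≡⟨ +-cong-mod {b = 1} {d = a} (binomialSum≡1-mod a (>-nonZero⁻¹ p) ≤-refl)
                                                   (trans (cong (_% p) (*-identityˡ (a ^ p))) (fermat a)) ⟩
    suc a % p                                 ∎

  fermat′ : ∀ {a} → ¬ p ∣ a → a ^ (p ∸ 1) ≡ 1 mod p
  fermat′ {a} p∤a = *-cancelˡ-mod p-prime p∤a (begin
    a * a ^ (p ∸ 1) % p ≡⟨ cong (_% p) (a*a^[n∸1]≡a^n a p) ⟩
    a ^ p % p           ≡⟨ fermat a ⟩
    a % p               ≡⟨ cong (_% p) (*-identityʳ a) ⟨
    a * 1 % p           ∎)

-- Periods and multiplicative orders

record Period (r : ℕ) .{{_ : NonZero r}} (a b t : ℕ) : Set where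
  constructor period
  field congruent : a ^ t ≡ b ^ t mod r

open Period

module _ {r : ℕ} .{{_ : NonZero r}} {a b : ℕ} where

  period-+ : ∀ {u v} → Period r a b u → Period r a b v → Period r a b (u + v)
  period-+ {u} {v} (period a^u≡b^u) (period a^v≡b^v) = period $
    subst₂ (λ x y → x ≡ y mod r) (sym (^-distribˡ-+-* a u v)) (sym (^-distribˡ-+-* b u v))
           (*-cong-mod a^u≡b^u a^v≡b^v)

  period-* : ∀ c {u} → Period r a b u → Period r a b (c * u)
  period-* zero    per-u = period refl
  period-* (suc c) per-u = period-+ per-u (period-* c per-u)

  ∣⇒period : ∀ {ℓ w} → ℓ ∣ w → Period r a b ℓ → Period r a b w
  ∣⇒period (divides c refl) per-ℓ = period-* c per-ℓ

module _ {p : ℕ} (p-prime : Prime p) {a b : ℕ} where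

  private instance
    p≢0 : NonZero p
    p≢0 = prime⇒nonZero p-prime

  period-∸ : ∀ {u v} → ¬ p ∣ a → Period p a b u → Period p a b (u + v) → Period p a b v
  period-∸ {u} {v} p∤a (period a^u≡b^u) (period a^[u+v]≡b^[u+v]) =
    period $ *-cancelˡ-mod p-prime (p∤a ∘ prime∣^⇒∣ p-prime u) (begin
      a ^ u * a ^ v % p ≡⟨ cong (_% p) (^-distribˡ-+-* a u v) ⟨
      a ^ (u + v) % p   ≡⟨ a^[u+v]≡b^[u+v] ⟩
      b ^ (u + v) % p   ≡⟨ cong (_% p) (^-distribˡ-+-* b u v) ⟩
      b ^ u * b ^ v % p ≡⟨ *-cong-mod {b = a ^ u} (sym a^u≡b^u) refl ⟩
      a ^ u * b ^ v % p ∎)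

  period-gcd : ∀ {m n d} → ¬ p ∣ a → GCD m n d → Period p a b m → Period p a b n → Period p a b d
  period-gcd {m} {n} {d} p∤a gcd per-m per-n with Bézout.identity gcd
  ... | Bézout.+- x y d+yn≡xm =
    period-∸ p∤a (period-* y per-n) (subst (Period p a b) (sym (trans (+-comm (y * n) d) d+yn≡xm)) (period-* x per-m))
  ... | Bézout.-+ x y d+xm≡yn =
    period-∸ p∤a (period-* x per-m) (subst (Period p a b) (sym (trans (+-comm (x * m) d) d+xm≡yn)) (period-* y per-n))

  period-fermat : ¬ p ∣ a → ¬ p ∣ b → Period p a b (p ∸ 1)
  period-fermat p∤a p∤b = period $ trans (fermat′ p-prime p∤a) (sym (fermat′ p-prime p∤b))

  order∣period : ∀ {ℓ w} → ¬ p ∣ a → b ≤ a → IsOrd a b p ℓ → Period p a b w → ℓ ∣ w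
  order∣period {zero}      _   _   (() , _)                      _
  order∣period {ℓ@(suc _)} {w} p∤a b≤a (_ , p∣a^ℓ∸b^ℓ , minimal) per-w with w % ℓ in w%ℓ≡r
  ... | zero  = m%n≡0⇒n∣m w ℓ w%ℓ≡r
  ... | suc r = contradiction (≡-mod⇒∣∸ (congruent per-r)) (minimal (suc r) (s≤s z≤n) r<ℓ)
    where
    r<ℓ : suc r < ℓ
    r<ℓ = subst (_< ℓ) w%ℓ≡r (m%n<n w ℓ)
    w≡[w/ℓ]*ℓ+r : w ≡ w / ℓ * ℓ + suc r
    w≡[w/ℓ]*ℓ+r = trans (m≡m%n+[m/n]*n w ℓ) (trans (cong (_+ w / ℓ * ℓ) w%ℓ≡r) (+-comm (suc r) _))
    per-r : Period p a b (suc r)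
    per-r = period-∸ p∤a (period-* (w / ℓ) (period (∣∸⇒≡-mod (^-monoˡ-≤ ℓ b≤a) p∣a^ℓ∸b^ℓ)))
                         (subst (Period p a b) w≡[w/ℓ]*ℓ+r per-w)

  order∣p∸1 : ∀ {ℓ} → ¬ p ∣ a → ¬ p ∣ b → b ≤ a → IsOrd a b p ℓ → ℓ ∣ p ∸ 1
  order∣p∸1 p∤a p∤b b≤a ord = order∣period p∤a b≤a ord (period-fermat p∤a p∤b)

  order∣⇒∣geomSum : ∀ {ℓ t} → 1 < ℓ → b ≤ a → IsOrd a b p ℓ → ℓ ∣ t → p ∣ geomSum t a b
  order∣⇒∣geomSum {ℓ} {t} 1<ℓ b≤a (_ , p∣a^ℓ∸b^ℓ , minimal) ℓ∣t
    with euclidsLemma (a ∸ b) (geomSum t a b) p-prime (subst (p ∣_) (^∸^≡[∸]*geomSum t b≤a) p∣a^t∸b^t)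
    where
    p∣a^t∸b^t : p ∣ a ^ t ∸ b ^ t
    p∣a^t∸b^t =
      ≡-mod⇒∣∸ (congruent (∣⇒period ℓ∣t (period (∣∸⇒≡-mod (^-monoˡ-≤ ℓ b≤a) p∣a^ℓ∸b^ℓ))))
  ... | inj₁ p∣a∸b = contradiction (subst₂ (λ u v → p ∣ u ∸ v) (sym (*-identityʳ a)) (sym (*-identityʳ b)) p∣a∸b)
                                   (minimal 1 (s≤s z≤n) 1<ℓ)
  ... | inj₂ p∣G   = p∣G

module _ {q : ℕ} (q-prime : Prime q) where

  private instance
    q≢0 : NonZero q
    q≢0 = prime⇒nonZero q-prime

  coprime∧period⇒∤ : ∀ {a b n} → Coprime a b → Period q a b (suc n) → ¬ q ∣ a
  coprime∧period⇒∤ {a} {b} {n} a⊥b (period a^[1+n]≡b^[1+n]) q∣a =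
    prime⇒∤1 q-prime (subst (q ∣_) (a⊥b (q∣a , q∣b)) ∣-refl)
    where
    q∣b : q ∣ b
    q∣b = prime∣^⇒∣ q-prime (suc n)
            (≡0-mod⇒∣ (trans (sym a^[1+n]≡b^[1+n]) (*-cong-mod {b = 0} (∣⇒≡0-mod q∣a) refl)))

  prime^∣[a^n∸b^n]⇒∣[a^[q∸1]∸b^[q∸1]] : ∀ j {n a b} → ¬ q ∣ n → Coprime a b → b ≤ a →
    q ^ j ∣ a ^ n ∸ b ^ n → q ^ j ∣ a ^ (q ∸ 1) ∸ b ^ (q ∸ 1)
  prime^∣[a^n∸b^n]⇒∣[a^[q∸1]∸b^[q∸1]] zero    _ _ _ _ = 1∣ _
  prime^∣[a^n∸b^n]⇒∣[a^[q∸1]∸b^[q∸1]] (suc j) {zero} q∤0 _ _ _ = contradiction (q ∣0) q∤0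
  prime^∣[a^n∸b^n]⇒∣[a^[q∸1]∸b^[q∸1]] (suc j) {n@(suc n′)} {a} {b} q∤n a⊥b b≤a q^[1+j]∣a^n∸b^n =
    ∣-trans q^[1+j]∣X∸Y (^∸^-mono-∣ d∣q∸1 b≤a)
    where
    per-n : Period q a b n
    per-n = period (∣∸⇒≡-mod (^-monoˡ-≤ n b≤a) (∣-trans (m∣m*n (q ^ j)) q^[1+j]∣a^n∸b^n))
    q∤a : ¬ q ∣ a
    q∤a = coprime∧period⇒∤ a⊥b per-n
    q∤b : ¬ q ∣ b
    q∤b = coprime∧period⇒∤ {n = n′} (Coprimality.sym a⊥b) (period (sym (congruent per-n)))
    d : ℕ
    d = gcd n (q ∸ 1)
    d∣n : d ∣ n
    d∣n = gcd[m,n]∣m n (q ∸ 1)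
    X Y t : ℕ
    X = a ^ d
    Y = b ^ d
    t = quotient d∣n
    d∣q∸1 : d ∣ q ∸ 1
    d∣q∸1 = gcd[m,n]∣n n (q ∸ 1)
    n≡t*d : n ≡ t * d
    n≡t*d = m∣n⇒n≡quotient*m d∣n
    X≡Y : X ≡ Y mod q
    X≡Y = congruent (period-gcd q-prime q∤a (gcd-GCD n (q ∸ 1)) per-n (period-fermat q-prime q∤a q∤b))
    q∤t : ¬ q ∣ t
    q∤t q∣t = q∤n (subst (q ∣_) (sym n≡t*d) (∣m⇒∣m*n d q∣t))
    q∤geomSum : ¬ q ∣ geomSum t X Y
    q∤geomSum q∣G with euclidsLemma t (X ^ (t ∸ 1)) q-prime
                         (≡0-mod⇒∣ (trans (sym (geomSum-cong-mod t X≡Y)) (∣⇒≡0-mod q∣G)))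
    ... | inj₁ q∣t        = q∤t q∣t
    ... | inj₂ q∣X^[t∸1] = q∤a (prime∣^⇒∣ q-prime d (prime∣^⇒∣ q-prime (t ∸ 1) q∣X^[t∸1]))
    a^n∸b^n≡[X∸Y]*G : a ^ n ∸ b ^ n ≡ (X ∸ Y) * geomSum t X Y
    a^n∸b^n≡[X∸Y]*G = trans (cong (λ k → a ^ k ∸ b ^ k) n≡t*d) (^[t*d]∸^[t*d]≡[^d∸^d]*geomSum t d b≤a)
    q^[1+j]∣X∸Y : q ^ suc j ∣ X ∸ Y
    q^[1+j]∣X∸Y = ^∣*-cancelʳ q-prime (suc j) q∤geomSum (subst (q ^ suc j ∣_) a^n∸b^n≡[X∸Y]*G q^[1+j]∣a^n∸b^n)

-- Euler's totient

count : (ℕ → Bool) → ℕ → ℕ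
count f zero    = 0
count f (suc n) = (if f 0 then 1 else 0) + count (f ∘ suc) n

count-cong : ∀ {f g} n → (∀ i → i < n → f i ≡ g i) → count f n ≡ count g n
count-cong zero    _   = refl
count-cong (suc n) f≗g = cong₂ (λ b c → (if b then 1 else 0) + c) (f≗g 0 (s≤s z≤n))
                               (count-cong n (λ i i<n → f≗g (suc i) (s≤s i<n)))

count-+ : ∀ f m n → count f (m + n) ≡ count f m + count (f ∘ (m +_)) n
count-+ f zero    n = refl
count-+ f (suc m) n = trans (cong ((if f 0 then 1 else 0) +_) (count-+ (f ∘ suc) m n))
                            (sym (+-assoc (if f 0 then 1 else 0) _ _))

count-periodic : ∀ f M c → (∀ i → f (M + i) ≡ f i) → count f (c * M) ≡ c * count f M
count-periodic f M zero    _        = refl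
count-periodic f M (suc c) periodic = begin
  count f (M + c * M)                    ≡⟨ count-+ f M (c * M) ⟩
  count f M + count (f ∘ (M +_)) (c * M) ≡⟨ cong (count f M +_) (count-cong (c * M) (λ i _ → periodic i)) ⟩
  count f M + count f (c * M)            ≡⟨ cong (count f M +_) (count-periodic f M c periodic) ⟩
  count f M + c * count f M              ∎

count-split : ∀ (f g : ℕ → Bool) n → count f n ≡ count (λ i → f i ∧ g i) n + count (λ i → f i ∧ not (g i)) n
count-split f g zero    = refl
count-split f g (suc n) with f 0 | g 0
... | false | _     = count-split (f ∘ suc) (g ∘ suc) n
... | true  | true  = cong suc (count-split (f ∘ suc) (g ∘ suc) n)
... | true  | false = trans (cong suc (count-split (f ∘ suc) (g ∘ suc) n)) (sym (+-suc _ _))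

count-false : ∀ {f} n → (∀ i → i < n → f i ≡ false) → count f n ≡ 0
count-false zero    _       = refl
count-false (suc n) f≡false rewrite f≡false 0 (s≤s z≤n) = count-false n (λ i i<n → f≡false (suc i) (s≤s i<n))

count≤ : ∀ f n → count f n ≤ n
count≤ f zero    = z≤n
count≤ f (suc n) with f 0
... | true  = s≤s (count≤ (f ∘ suc) n)
... | false = m≤n⇒m≤1+n (count≤ (f ∘ suc) n)

count-first-multiple : ∀ n .{{_ : NonZero n}} (F : ℕ → Bool) →
  count (λ i → F (suc i) ∧ does (n ∣? suc i)) n ≡ (if F n then 1 else 0)
count-first-multiple n@(suc n′) F = begin
  count H (suc n′)                   ≡⟨ cong (count H) (+-comm 1 n′) ⟩
  count H (n′ + 1)                   ≡⟨ count-+ H n′ 1 ⟩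
  count H n′ + count (H ∘ (n′ +_)) 1 ≡⟨ cong₂ _+_ (count-false n′ none-below)
                                                  (cong (λ b → (if b then 1 else 0) + 0) H[n′]≡F[n]) ⟩
  (if F n then 1 else 0) + 0         ≡⟨ +-identityʳ _ ⟩
  (if F n then 1 else 0)             ∎
  where
  H : ℕ → Bool
  H i = F (suc i) ∧ does (n ∣? suc i)
  none-below : ∀ i → i < n′ → H i ≡ false
  none-below i i<n′ = trans (cong (F (suc i) ∧_) (dec-false (n ∣? suc i) λ n∣1+i → <⇒≱ (s≤s i<n′) (∣⇒≤ n∣1+i)))
                            (∧-zeroʳ (F (suc i)))
  H[n′]≡F[n] : H (n′ + 0) ≡ F n
  H[n′]≡F[n] rewrite +-identityʳ n′ | dec-true (n ∣? n) ∣-refl = ∧-identityʳ (F n)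

count-multiples : ∀ n .{{_ : NonZero n}} (F : ℕ → Bool) K →
  count (λ i → F (suc i) ∧ does (n ∣? suc i)) (n * K) ≡ count (λ j → F (n * suc j)) K
count-multiples n F zero    = cong (count _) (*-zeroʳ n)
count-multiples n F (suc K) = begin
  count H (n * suc K)                    ≡⟨ cong (count H) (*-suc n K) ⟩
  count H (n + n * K)                    ≡⟨ count-+ H n (n * K) ⟩
  count H n + count (H ∘ (n +_)) (n * K) ≡⟨ cong₂ _+_ first-block later-blocks ⟩
  count (λ j → F (n * suc j)) (suc K)    ∎
  where
  H : ℕ → Bool
  H i = F (suc i) ∧ does (n ∣? suc i)
  first-block : count H n ≡ (if F (n * 1) then 1 else 0)
  first-block = trans (count-first-multiple n F) (cong (λ k → if F k then 1 else 0) (sym (*-identityʳ n)))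
  n∣n+k⇔n∣k : ∀ k → n ∣ n + k ⇔ n ∣ k
  n∣n+k⇔n∣k k = mk⇔ (λ n∣n+k → ∣m+n∣m⇒∣n n∣n+k ∣-refl) (∣m∣n⇒∣m+n ∣-refl)
  shift : ∀ i → H (n + i) ≡ F (n + suc i) ∧ does (n ∣? suc i)
  shift i = cong₂ _∧_ (cong F (sym (+-suc n i)))
    (does-⇔ (subst (λ k → n ∣ k ⇔ n ∣ suc i) (+-suc n i) (n∣n+k⇔n∣k (suc i))) (n ∣? suc (n + i)) (n ∣? suc i))
  later-blocks : count (H ∘ (n +_)) (n * K) ≡ count (λ j → F (n * suc (suc j))) K
  later-blocks = begin
    count (H ∘ (n +_)) (n * K)                              ≡⟨ count-cong (n * K) (λ i _ → shift i) ⟩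
    count (λ i → F (n + suc i) ∧ does (n ∣? suc i)) (n * K) ≡⟨ count-multiples n (F ∘ (n +_)) K ⟩
    count (λ j → F (n + n * suc j)) K                       ≡⟨ count-cong K (λ j _ → cong F (sym (*-suc n (suc j)))) ⟩
    count (λ j → F (n * suc (suc j))) K                     ∎

length-filter-applyUpTo : ∀ {P : ℕ → Set} (P? : Decidable P) h n →
  length (filter P? (applyUpTo h n)) ≡ count (λ i → does (P? (h i))) n
length-filter-applyUpTo P? h zero    = refl
length-filter-applyUpTo P? h (suc n) with does (P? (h 0))
... | true  = cong suc (length-filter-applyUpTo P? (h ∘ suc) n)
... | false = length-filter-applyUpTo P? (h ∘ suc) n

map-applyUpTo : ∀ (g h : ℕ → ℕ) n → map g (applyUpTo h n) ≡ applyUpTo (g ∘ h) n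
map-applyUpTo g h zero    = refl
map-applyUpTo g h (suc n) = cong (g (h 0) ∷_) (map-applyUpTo g (h ∘ suc) n)

coprimeᵇ : ℕ → ℕ → Bool
coprimeᵇ k n = does (gcd k n ≟ 1)

φ≡count : ∀ n → φ n ≡ count (λ i → coprimeᵇ (suc i) n) n
φ≡count n = trans (cong (λ ks → length (filter (λ k → gcd k n ≟ 1) ks)) (map-applyUpTo suc id n))
                  (length-filter-applyUpTo (λ k → gcd k n ≟ 1) suc n)

φ≤n : ∀ n → φ n ≤ n
φ≤n n = subst (_≤ n) (sym (φ≡count n)) (count≤ _ n)

coprimeᵇ-cong : ∀ k m k′ m′ → Coprime k m ⇔ Coprime k′ m′ → coprimeᵇ k m ≡ coprimeᵇ k′ m′
coprimeᵇ-cong k m k′ m′ k⊥m⇔k′⊥m′ = does-⇔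
  (mk⇔ (coprime⇒gcd≡1 ∘ to ∘ gcd≡1⇒coprime) (coprime⇒gcd≡1 ∘ from ∘ gcd≡1⇒coprime)) (gcd k m ≟ 1) (gcd k′ m′ ≟ 1)
  where open Equivalence k⊥m⇔k′⊥m′

coprime-* : ∀ {k a b} → Coprime k a → Coprime k b → Coprime k (a * b)
coprime-* {k} {a} k⊥a k⊥b {i} (i∣k , i∣ab) = k⊥b (i∣k , coprime-divisor i⊥a i∣ab)
  where
  i⊥a : Coprime i a
  i⊥a (j∣i , j∣a) = k⊥a (∣-trans j∣i i∣k , j∣a)

coprime-*ˡ⇔ : ∀ {c k m} → (∀ {i} → i ∣ c → i ∣ k → i ∣ m) → Coprime k (c * m) ⇔ Coprime k m
coprime-*ˡ⇔ {c} {k} {m} divisors-of-c = mk⇔ to from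
  where
  to : Coprime k (c * m) → Coprime k m
  to k⊥cm (i∣k , i∣m) = k⊥cm (i∣k , ∣n⇒∣m*n c i∣m)
  from : Coprime k m → Coprime k (c * m)
  from k⊥m = coprime-* (λ (i∣k , i∣c) → k⊥m (i∣k , divisors-of-c i∣c i∣k)) k⊥m

coprime-+ˡ⇔ : ∀ {k m} → Coprime (m + k) m ⇔ Coprime k m
coprime-+ˡ⇔ {k} {m} = mk⇔ to from
  where
  to : Coprime (m + k) m → Coprime k m
  to m+k⊥m (i∣k , i∣m) = m+k⊥m (∣m∣n⇒∣m+n i∣m i∣k , i∣m)
  from : Coprime k m → Coprime (m + k) m
  from k⊥m (i∣m+k , i∣m) = k⊥m (∣m+n∣m⇒∣n i∣m+k i∣m , i∣m)

module _ {p : ℕ} (p-prime : Prime p) where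

  ∤⇒coprime : ∀ {k} → ¬ p ∣ k → Coprime k p
  ∤⇒coprime p∤k {i} (i∣k , i∣p) with prime⇒irreducible p-prime i∣p
  ... | inj₁ i≡1 = i≡1
  ... | inj₂ refl = contradiction i∣k p∤k

  ∣⇒¬coprime : ∀ {k m} → p ∣ k → ¬ Coprime k (p * m)
  ∣⇒¬coprime {m = m} p∣k k⊥pm = prime⇒∤1 p-prime (subst (p ∣_) (k⊥pm (p∣k , m∣m*n m)) ∣-refl)

  coprime-prime*ʳ⇔ : ∀ {k m} → ¬ p ∣ k → Coprime k (p * m) ⇔ Coprime k m
  coprime-prime*ʳ⇔ p∤k = coprime-*ˡ⇔ λ i∣p i∣k → subst (_∣ _) (sym (∤⇒coprime p∤k (i∣k , i∣p))) (1∣ _)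

  coprime-prime*ˡ⇔ : ∀ {k m} → ¬ p ∣ m → Coprime (p * k) m ⇔ Coprime k m
  coprime-prime*ˡ⇔ {k} {m} p∤m = mk⇔ to from
    where
    to : Coprime (p * k) m → Coprime k m
    to pk⊥m (i∣k , i∣m) = pk⊥m (∣n⇒∣m*n p i∣k , i∣m)
    from : Coprime k m → Coprime (p * k) m
    from k⊥m = Coprimality.sym (coprime-* (∤⇒coprime p∤m) (Coprimality.sym k⊥m))

count-coprime-periodic : ∀ m c → count (λ i → coprimeᵇ (suc i) m) (c * m) ≡ c * φ m
count-coprime-periodic m c = begin
  count (λ i → coprimeᵇ (suc i) m) (c * m) ≡⟨ count-periodic _ m c shift ⟩
  c * count (λ i → coprimeᵇ (suc i) m) m   ≡⟨ cong (c *_) (φ≡count m) ⟨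
  c * φ m                                  ∎
  where
  shift : ∀ i → coprimeᵇ (suc (m + i)) m ≡ coprimeᵇ (suc i) m
  shift i = coprimeᵇ-cong (suc (m + i)) m (suc i) m
              (subst (λ k → Coprime k m ⇔ Coprime (suc i) m) (+-suc m i) coprime-+ˡ⇔)

φ[c*m]≡c*φ[m] : ∀ {c m} → c ∣ m → φ (c * m) ≡ c * φ m
φ[c*m]≡c*φ[m] {c} {m} c∣m = begin
  φ (c * m)                                      ≡⟨ φ≡count (c * m) ⟩
  count (λ i → coprimeᵇ (suc i) (c * m)) (c * m) ≡⟨ count-cong (c * m) (λ i _ → coprimeᵇ[k,c*m]≡coprimeᵇ[k,m] (suc i)) ⟩
  count (λ i → coprimeᵇ (suc i) m) (c * m)       ≡⟨ count-coprime-periodic m c ⟩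
  c * φ m                                        ∎
  where
  coprimeᵇ[k,c*m]≡coprimeᵇ[k,m] : ∀ k → coprimeᵇ k (c * m) ≡ coprimeᵇ k m
  coprimeᵇ[k,c*m]≡coprimeᵇ[k,m] k = coprimeᵇ-cong k (c * m) k m (coprime-*ˡ⇔ (λ d∣c _ → ∣-trans d∣c c∣m))

module _ {p : ℕ} (p-prime : Prime p) where

  private instance
    p≢0 : NonZero p
    p≢0 = prime⇒nonZero p-prime

  coprimeᵇ-prime* : ∀ k m → coprimeᵇ k (p * m) ≡ coprimeᵇ k m ∧ not (does (p ∣? k))
  coprimeᵇ-prime* k m with p ∣? k
  ... | yes p∣k = trans (dec-false (gcd k (p * m) ≟ 1) (∣⇒¬coprime p-prime p∣k ∘ gcd≡1⇒coprime)) (sym (∧-zeroʳ _))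
  ... | no  p∤k = trans (coprimeᵇ-cong k (p * m) k m (coprime-prime*ʳ⇔ p-prime p∤k)) (sym (∧-identityʳ _))

  -- Of the p·φ m integers in [1, p m] prime to m, those prime to p are counted by φ (p m),
  -- and the multiples p j of p are counted by φ m, as p j is prime to m exactly when j is.
  φ[p*m]+φ[m]≡p*φ[m] : ∀ {m} → ¬ p ∣ m → φ (p * m) + φ m ≡ p * φ m
  φ[p*m]+φ[m]≡p*φ[m] {m} p∤m = begin
    φ (p * m) + φ m                                  ≡⟨ cong₂ _+_ φ[p*m]≡count-∤ φ[m]≡count-∣ ⟩
    count c∧¬d (p * m) + count c∧d (p * m)           ≡⟨ +-comm (count c∧¬d (p * m)) _ ⟩
    count c∧d (p * m) + count c∧¬d (p * m)           ≡⟨ count-split c d (p * m) ⟨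
    count c (p * m)                                  ≡⟨ count-coprime-periodic m p ⟩
    p * φ m                                          ∎
    where
    c d c∧d c∧¬d : ℕ → Bool
    c i = coprimeᵇ (suc i) m
    d i = does (p ∣? suc i)
    c∧d i = c i ∧ d i
    c∧¬d i = c i ∧ not (d i)
    φ[p*m]≡count-∤ : φ (p * m) ≡ count c∧¬d (p * m)
    φ[p*m]≡count-∤ = trans (φ≡count (p * m)) (count-cong (p * m) (λ i _ → coprimeᵇ-prime* (suc i) m))
    φ[m]≡count-∣ : φ m ≡ count c∧d (p * m)
    φ[m]≡count-∣ = sym (begin
      count c∧d (p * m)                      ≡⟨ count-multiples p (λ k → coprimeᵇ k m) m ⟩
      count (λ j → coprimeᵇ (p * suc j) m) m ≡⟨ count-cong m (λ j _ → coprimeᵇ-cong (p * suc j) m (suc j) m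
                                                                          (coprime-prime*ˡ⇔ p-prime p∤m)) ⟩
      count c m                              ≡⟨ φ≡count m ⟨
      φ m                                    ∎)

  φ[p*m]≡[p∸1]*φ[m] : ∀ {m} → ¬ p ∣ m → φ (p * m) ≡ (p ∸ 1) * φ m
  φ[p*m]≡[p∸1]*φ[m] {m} p∤m = +-cancelʳ-≡ (φ m) _ _ (begin
    φ (p * m) + φ m     ≡⟨ φ[p*m]+φ[m]≡p*φ[m] p∤m ⟩
    p * φ m             ≡⟨ cong (_* φ m) (suc-pred p) ⟨
    suc (p ∸ 1) * φ m   ≡⟨ +-comm (φ m) _ ⟩
    (p ∸ 1) * φ m + φ m ∎)

  φ[p^[1+v]*m]≡p^v*[p∸1]*φ[m] : ∀ v {m} → ¬ p ∣ m → φ (p ^ suc v * m) ≡ p ^ v * ((p ∸ 1) * φ m)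
  φ[p^[1+v]*m]≡p^v*[p∸1]*φ[m] zero    {m} p∤m = begin
    φ (p * 1 * m)       ≡⟨ cong (λ k → φ (k * m)) (*-identityʳ p) ⟩
    φ (p * m)           ≡⟨ φ[p*m]≡[p∸1]*φ[m] p∤m ⟩
    (p ∸ 1) * φ m       ≡⟨ +-identityʳ _ ⟨
    1 * ((p ∸ 1) * φ m) ∎
  φ[p^[1+v]*m]≡p^v*[p∸1]*φ[m] (suc v) {m} p∤m = begin
    φ (p * p ^ suc v * m)         ≡⟨ cong φ (*-assoc p (p ^ suc v) m) ⟩
    φ (p * (p ^ suc v * m))       ≡⟨ φ[c*m]≡c*φ[m] {p} (∣m⇒∣m*n m (m∣m*n (p ^ v))) ⟩
    p * φ (p ^ suc v * m)         ≡⟨ cong (p *_) (φ[p^[1+v]*m]≡p^v*[p∸1]*φ[m] v p∤m) ⟩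
    p * (p ^ v * ((p ∸ 1) * φ m)) ≡⟨ *-assoc p (p ^ v) _ ⟨
    p * p ^ v * ((p ∸ 1) * φ m)   ∎

  factorOut : ∀ n .{{_ : NonZero n}} → ∃₂ λ α m → n ≡ p ^ α * m × ¬ p ∣ m
  factorOut = <-rec Split split
    where
    Split : ℕ → Set
    Split n = .{{_ : NonZero n}} → ∃₂ λ α m → n ≡ p ^ α * m × ¬ p ∣ m
    split : ∀ n → WfRec _<_ Split n → Split n
    split n rec with p ∣? n
    ... | no p∤n = 0 , n , sym (*-identityˡ n) , p∤n
    ... | yes (divides k refl) with rec {k} k<k*p {{m*n≢0⇒m≢0 k}}
      where
      k<k*p : k < k * p
      k<k*p = m<m*n k p {{m*n≢0⇒m≢0 k}} (nonTrivial⇒n>1 p {{prime⇒nonTrivial p-prime}})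
    ... | α , m , k≡p^α*m , p∤m =
      suc α , m , trans (cong (_* p) k≡p^α*m) (trans (*-comm _ p) (sym (*-assoc p (p ^ α) m))) , p∤m

  ^∣^⇒≤ : ∀ {e α} → p ^ e ∣ p ^ α → e ≤ α
  ^∣^⇒≤ {e} {α} p^e∣p^α = ≮⇒≥ λ α<e →
    <⇒≱ (^-monoʳ-< p (nonTrivial⇒n>1 p {{prime⇒nonTrivial p-prime}}) α<e) (∣⇒≤ {{m^n≢0 p α}} p^e∣p^α)

  ^[α∸1]∣φ[p^α*m] : ∀ α {m} → ¬ p ∣ m → p ^ (α ∸ 1) ∣ φ (p ^ α * m)
  ^[α∸1]∣φ[p^α*m] zero    _   = 1∣ _
  ^[α∸1]∣φ[p^α*m] (suc α) p∤m = subst (p ^ α ∣_) (sym (φ[p^[1+v]*m]≡p^v*[p∸1]*φ[m] α p∤m)) (m∣m*n _)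

  ^∣⇒^[∸1]∣φ : ∀ e {n} .{{_ : NonZero n}} → p ^ e ∣ n → p ^ (e ∸ 1) ∣ φ n
  ^∣⇒^[∸1]∣φ e {n} p^e∣n with factorOut n
  ... | α , m , refl , p∤m = ∣-trans (^-monoʳ-∣ p (∸-monoˡ-≤ 1 e≤α)) (^[α∸1]∣φ[p^α*m] α p∤m)
    where
    e≤α : e ≤ α
    e≤α = ^∣^⇒≤ (^∣*-cancelʳ p-prime e p∤m p^e∣n)

module _ {q : ℕ} (q-prime : Prime q) where

  private instance
    q≢0 : NonZero q
    q≢0 = prime⇒nonZero q-prime

  ^∣⇒^[#ps+e∸1]∣φ : ∀ e ps {n} .{{_ : NonZero n}} → q ^ e ∣ n → Unique ps →
    All (λ p → Prime p × p ∣ n × q ∣ p ∸ 1) ps → q ^ (length ps + (e ∸ 1)) ∣ φ n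
  ^∣⇒^[#ps+e∸1]∣φ e []       q^e∣n _ _ = ^∣⇒^[∸1]∣φ q-prime e q^e∣n
  ^∣⇒^[#ps+e∸1]∣φ e (p ∷ ps) {n} q^e∣n (p∉ps ∷ unique) ((p-prime , p∣n , q∣p∸1) ∷ conds)
    with factorOut p-prime n
  ... | zero  , m , refl , p∤m = contradiction (subst (p ∣_) (+-identityʳ m) p∣n) p∤m
  ... | suc α , m , refl , p∤m =
    subst (q ^ suc (length ps + (e ∸ 1)) ∣_) (sym (φ[p^[1+v]*m]≡p^v*[p∸1]*φ[m] p-prime α p∤m))
          (∣n⇒∣m*n (p ^ α) (*-pres-∣ q∣p∸1 (^∣⇒^[#ps+e∸1]∣φ e ps q^e∣m unique conds′)))
    where
    instance
      m≢0 : NonZero m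
      m≢0 = m*n≢0⇒n≢0 (p ^ suc α)
    ∤p^[1+α] : ∀ {p′} → Prime p′ → p′ ≢ p → ¬ p′ ∣ p ^ suc α
    ∤p^[1+α] p′-prime p′≢p = p′≢p ∘ ∣prime⇒≡ p-prime p′-prime ∘ prime∣^⇒∣ p′-prime (suc α)
    q≢p : q ≢ p
    q≢p refl = n∤n∸1 q {{prime⇒nonTrivial q-prime}} q∣p∸1
    q^e∣m : q ^ e ∣ m
    q^e∣m = ^∣*-cancelʳ q-prime e (∤p^[1+α] q-prime q≢p) (subst (q ^ e ∣_) (*-comm _ m) q^e∣n)
    ∣m : ∀ {p′} → Prime p′ → p′ ≢ p → p′ ∣ p ^ suc α * m → p′ ∣ m
    ∣m p′-prime p′≢p p′∣n with euclidsLemma (p ^ suc α) m p′-prime p′∣n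
    ... | inj₁ p′∣p^[1+α] = contradiction p′∣p^[1+α] (∤p^[1+α] p′-prime p′≢p)
    ... | inj₂ p′∣m       = p′∣m
    conds′ : All (λ p′ → Prime p′ × p′ ∣ m × q ∣ p′ ∸ 1) ps
    conds′ = All.zipWith
      (λ (p≢p′ , p′-prime , p′∣n , q∣p′∸1) → p′-prime , ∣m p′-prime (p≢p′ ∘ sym) p′∣n , q∣p′∸1)
      (p∉ps , conds)

  φ≡c*G⇒^[#ps∸1]∣G : ∀ {N c G} ps .{{_ : NonZero N}} → c ∣ N → φ N ≡ c * G → Unique ps →
    All (λ p → Prime p × p ∣ N × q ∣ p ∸ 1) ps → q ^ (length ps ∸ 1) ∣ G
  φ≡c*G⇒^[#ps∸1]∣G []       _ _ _ _ = 1∣ _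
  φ≡c*G⇒^[#ps∸1]∣G {N} {c} {G} ps@(_ ∷ ps′) c∣N φN≡cG unique conds with factorOut q-prime c {{c≢0}}
    where
    c≢0 : NonZero c
    c≢0 = ≢-nonZero λ { refl → ≢-nonZero⁻¹ N (0∣⇒≡0 c∣N) }
  ... | γ , c′ , refl , q∤c′ =
    ^∣*-cancelʳ q-prime (length ps′) q∤c′ (subst (q ^ length ps′ ∣_) (*-comm c′ G) q^#ps′∣c′G)
    where
    q^[γ+#ps′]∣q^γc′G : q ^ (γ + length ps′) ∣ q ^ γ * c′ * G
    q^[γ+#ps′]∣q^γc′G = subst (q ^ (γ + length ps′) ∣_) φN≡cG
      (∣-trans (^-monoʳ-∣ q (m+n≤1+n+[m∸1] γ (length ps′)))
               (^∣⇒^[#ps+e∸1]∣φ γ ps (∣-trans (m∣m*n c′) c∣N) unique conds))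
    q^#ps′∣c′G : q ^ length ps′ ∣ c′ * G
    q^#ps′∣c′G = *-cancelˡ-∣ (q ^ γ) {{m^n≢0 q γ}}
      (subst₂ _∣_ (^-distribˡ-+-* q γ (length ps′)) (*-assoc (q ^ γ) c′ G) q^[γ+#ps′]∣q^γc′G)

[ga^t∸gb^t]÷[ga∸gb]≡g^[t∸1]*geomSum : ∀ t {g a b} .{{_ : NonZero t}} .{{_ : NonZero g}} → b < a →
  ((g * a) ^ t ∸ (g * b) ^ t) ÷ (g * a ∸ g * b) ≡ g ^ (t ∸ 1) * geomSum t a b
[ga^t∸gb^t]÷[ga∸gb]≡g^[t∸1]*geomSum t {g} {a} {b} b<a = begin
  ((g * a) ^ t ∸ (g * b) ^ t) ÷ (g * a ∸ g * b)                 ≡⟨ cong₂ _÷_ numerator (sym (*-distribˡ-∸ g a b)) ⟩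
  (g ^ (t ∸ 1) * geomSum t a b * (g * (a ∸ b))) ÷ (g * (a ∸ b)) ≡⟨ m*n÷n≡m _ (g * (a ∸ b)) {{m*n≢0 g (a ∸ b)}} ⟩
  g ^ (t ∸ 1) * geomSum t a b                                   ∎
  where
  instance
    a∸b≢0 : NonZero (a ∸ b)
    a∸b≢0 = >-nonZero (m<n⇒0<n∸m b<a)
  numerator : (g * a) ^ t ∸ (g * b) ^ t ≡ g ^ (t ∸ 1) * geomSum t a b * (g * (a ∸ b))
  numerator = begin
    (g * a) ^ t ∸ (g * b) ^ t                   ≡⟨ cong₂ _∸_ ([m*n]^t≡m^t*n^t g a t) ([m*n]^t≡m^t*n^t g b t) ⟩
    g ^ t * a ^ t ∸ g ^ t * b ^ t               ≡⟨ *-distribˡ-∸ (g ^ t) (a ^ t) (b ^ t) ⟨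
    g ^ t * (a ^ t ∸ b ^ t)                     ≡⟨ cong₂ _*_ (sym (a*a^[n∸1]≡a^n g t)) (^∸^≡[∸]*geomSum t (<⇒≤ b<a)) ⟩
    g * g ^ (t ∸ 1) * ((a ∸ b) * geomSum t a b) ≡⟨ [m*n]*[o*p]≡[m*o]*[n*p] g (g ^ (t ∸ 1)) (a ∸ b) (geomSum t a b) ⟩
    g * (a ∸ b) * (g ^ (t ∸ 1) * geomSum t a b) ≡⟨ *-comm (g * (a ∸ b)) _ ⟩
    g ^ (t ∸ 1) * geomSum t a b * (g * (a ∸ b)) ∎

module _ {x y : ℕ} (0<y : 0 < y) where

  private
    g : ℕ
    g = gcd x y
    instance
      g≢0 : NonZero g
      g≢0 = ≢-nonZero (gcd[m,n]≢0 x y (inj₂ (≢-nonZero⁻¹ y {{>-nonZero 0<y}})))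
    x≡g*[x÷g] : x ≡ g * (x ÷ g)
    x≡g*[x÷g] = sym (trans (cong (g *_) (m÷n≡m/n x g)) (m*[n/m]≡n (gcd[m,n]∣m x y)))
    y≡g*[y÷g] : y ≡ g * (y ÷ g)
    y≡g*[y÷g] = sym (trans (cong (g *_) (m÷n≡m/n y g)) (m*[n/m]≡n (gcd[m,n]∣n x y)))
    y÷g<x÷g : y < x → y ÷ g < x ÷ g
    y÷g<x÷g y<x = *-cancelˡ-< g (y ÷ g) (x ÷ g) (subst₂ _<_ y≡g*[y÷g] x≡g*[x÷g] y<x)

  reduced-pair : y < x → 0 < g × 0 < y ÷ g × y ÷ g < x ÷ g × Coprime (x ÷ g) (y ÷ g)
  reduced-pair y<x =
    >-nonZero⁻¹ g ,
    n≢0⇒n>0 (λ y÷g≡0 → <⇒≢ 0<y (sym (trans y≡g*[y÷g] (trans (cong (g *_) y÷g≡0) (*-zeroʳ g))))) ,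
    y÷g<x÷g y<x ,
    subst₂ Coprime (sym (m÷n≡m/n x g)) (sym (m÷n≡m/n y g)) (coprime-/gcd x y)

  [x^t∸y^t]÷[x∸y]≡g^[t∸1]*geomSum : ∀ t .{{_ : NonZero t}} → y < x →
    (x ^ t ∸ y ^ t) ÷ (x ∸ y) ≡ g ^ (t ∸ 1) * geomSum t (x ÷ g) (y ÷ g)
  [x^t∸y^t]÷[x∸y]≡g^[t∸1]*geomSum t y<x =
    subst₂ (λ u v → (u ^ t ∸ v ^ t) ÷ (u ∸ v) ≡ g ^ (t ∸ 1) * geomSum t (x ÷ g) (y ÷ g))
           (sym x≡g*[x÷g]) (sym y≡g*[y÷g])
           ([ga^t∸gb^t]÷[ga∸gb]≡g^[t∸1]*geomSum t (y÷g<x÷g y<x))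

φ-equation⇒n≤m : ∀ {z g a b m n} → 0 < z → 0 < g → 0 < b → b < a →
  φ (z * (g ^ (m ∸ 1) * geomSum m a b)) ≡ z * (g ^ (n ∸ 1) * geomSum n a b) → n ≤ m
φ-equation⇒n≤m {z} {g} {a} {b} {m} {n} 0<z 0<g 0<b b<a φN≡R = ≮⇒≥ λ m<n → <⇒≱ (N<R m<n) R≤N
  where
  instance
    z≢0 : NonZero z
    z≢0 = >-nonZero 0<z
    g≢0 : NonZero g
    g≢0 = >-nonZero 0<g
  R≤N : z * (g ^ (n ∸ 1) * geomSum n a b) ≤ z * (g ^ (m ∸ 1) * geomSum m a b)
  R≤N = subst (_≤ z * (g ^ (m ∸ 1) * geomSum m a b)) φN≡R (φ≤n _)
  N<R : m < n → z * (g ^ (m ∸ 1) * geomSum m a b) < z * (g ^ (n ∸ 1) * geomSum n a b)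
  N<R m<n = *-monoʳ-< z (≤-<-trans
    (*-monoˡ-≤ (geomSum m a b) (^-monoʳ-≤ g (∸-monoˡ-≤ 1 (<⇒≤ m<n))))
    (*-monoʳ-< (g ^ (n ∸ 1)) {{m^n≢0 g (n ∸ 1)}} (geomSum-monoˡ-< (<-≤-trans 0<b (<⇒≤ b<a)) 0<b m<n)))

QualifyingPrime : (a b m q p : ℕ) → Set
QualifyingPrime a b m q p = Prime p × ¬ (2 ∣ p) × ¬ (p ∣ (a * b)) × ∃ (λ ℓ → IsOrd a b p ℓ × ℓ ∣ m × q ∣ ℓ)

qualifyingPrime⇒∣geomSum : ∀ {a b m q p} → Prime q → b ≤ a → QualifyingPrime a b m q p →
  Prime p × p ∣ geomSum m a b × q ∣ p ∸ 1
qualifyingPrime⇒∣geomSum {a} {b} {m} {q} {p} q-prime b≤a (p-prime , _ , p∤ab , ℓ , ord@(0<ℓ , _) , ℓ∣m , q∣ℓ) =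
  p-prime , order∣⇒∣geomSum p-prime 1<ℓ b≤a ord ℓ∣m , ∣-trans q∣ℓ (order∣p∸1 p-prime p∤a p∤b b≤a ord)
  where
  p∤a : ¬ p ∣ a
  p∤a = p∤ab ∘ ∣m⇒∣m*n b
  p∤b : ¬ p ∣ b
  p∤b = p∤ab ∘ ∣n⇒∣m*n a
  1<ℓ : 1 < ℓ
  1<ℓ = <-≤-trans (nonTrivial⇒n>1 q {{prime⇒nonTrivial q-prime}}) (∣⇒≤ {{>-nonZero 0<ℓ}} q∣ℓ)

qualifyingPrimes-bound : ∀ {g a b z m n q k} ps → 0 < g → 0 < b → b < a → Coprime a b → 0 < z → 0 < m →
  φ (z * (g ^ (m ∸ 1) * geomSum m a b)) ≡ z * (g ^ (n ∸ 1) * geomSum n a b) → gcd m n ≡ 1 →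
  Prime q → q ∣ m → ¬ q ^ k ∣ a ^ (q ∸ 1) ∸ b ^ (q ∸ 1) → Unique ps →
  All (QualifyingPrime a b m q) ps → length ps ≤ k
qualifyingPrimes-bound {g} {a} {b} {z} {m} {n} {q} {k} ps 0<g 0<b b<a a⊥b 0<z 0<m φN≡R gcd[m,n]≡1
                       q-prime q∣m q^k∤ unique qualifying =
  ≤-trans (m≤n+m∸n (length ps) 1) (≰⇒> λ k≤#ps∸1 → q^k∤ (∣-trans (^-monoʳ-∣ q k≤#ps∸1) q^[#ps∸1]∣a^[q∸1]∸b^[q∸1]))
  where
  instance
    z≢0 : NonZero z
    z≢0 = >-nonZero 0<z
    g≢0 : NonZero g
    g≢0 = >-nonZero 0<g
    geomSum≢0 : NonZero (geomSum m a b)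
    geomSum≢0 = >-nonZero (geomSum>0 m b (<-≤-trans 0<b (<⇒≤ b<a)) 0<m)
    N≢0 : NonZero (z * (g ^ (m ∸ 1) * geomSum m a b))
    N≢0 = m*n≢0 z _ {{z≢0}} {{m*n≢0 _ _ {{m^n≢0 g (m ∸ 1)}} {{geomSum≢0}}}}
  q∤n : ¬ q ∣ n
  q∤n q∣n = prime⇒∤1 q-prime (subst (q ∣_) gcd[m,n]≡1 (gcd-greatest q∣m q∣n))
  n≤m : n ≤ m
  n≤m = φ-equation⇒n≤m 0<z 0<g 0<b b<a φN≡R
  c∣N : z * g ^ (n ∸ 1) ∣ z * (g ^ (m ∸ 1) * geomSum m a b)
  c∣N = subst (z * g ^ (n ∸ 1) ∣_) (*-assoc z (g ^ (m ∸ 1)) (geomSum m a b))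
          (∣m⇒∣m*n (geomSum m a b) (*-monoʳ-∣ z (^-monoʳ-∣ g (∸-monoˡ-≤ 1 n≤m))))
  counted : All (λ p → Prime p × p ∣ z * (g ^ (m ∸ 1) * geomSum m a b) × q ∣ p ∸ 1) ps
  counted = All.map (λ qualifies → let p-prime , p∣G , q∣p∸1 = qualifyingPrime⇒∣geomSum q-prime (<⇒≤ b<a) qualifies
                                   in p-prime , ∣-trans p∣G (∣n⇒∣m*n z (∣n⇒∣m*n (g ^ (m ∸ 1)) ∣-refl)) , q∣p∸1)
                    qualifying
  q^[#ps∸1]∣geomSum : q ^ (length ps ∸ 1) ∣ geomSum n a b
  q^[#ps∸1]∣geomSum = φ≡c*G⇒^[#ps∸1]∣G q-prime ps c∣N (trans φN≡R (sym (*-assoc z (g ^ (n ∸ 1)) (geomSum n a b))))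
                        unique counted
  q^[#ps∸1]∣a^n∸b^n : q ^ (length ps ∸ 1) ∣ a ^ n ∸ b ^ n
  q^[#ps∸1]∣a^n∸b^n = subst (q ^ (length ps ∸ 1) ∣_) (sym (^∸^≡[∸]*geomSum n (<⇒≤ b<a)))
                            (∣n⇒∣m*n (a ∸ b) q^[#ps∸1]∣geomSum)
  q^[#ps∸1]∣a^[q∸1]∸b^[q∸1] : q ^ (length ps ∸ 1) ∣ a ^ (q ∸ 1) ∸ b ^ (q ∸ 1)
  q^[#ps∸1]∣a^[q∸1]∸b^[q∸1] =
    prime^∣[a^n∸b^n]⇒∣[a^[q∸1]∸b^[q∸1]] q-prime (length ps ∸ 1) q∤n a⊥b (<⇒≤ b<a) q^[#ps∸1]∣a^n∸b^n

lemma13 : (x y z m n : ℕ) → 0 < y → 0 < z → 0 < m → 0 < n → y < x →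
    φ (z * ((x ^ m ∸ y ^ m) ÷ (x ∸ y))) ≡ z * ((x ^ n ∸ y ^ n) ÷ (x ∸ y)) →
    ¬ (z ≡ 1 × m ≡ 1 × n ≡ 1) →
    x ≤ 80 → z ≤ x ∸ y → gcd m n ≡ 1 →
    (q k : ℕ) → Prime q → q ∣ m → 0 < k →
    ¬ ((q ^ k) ∣ ((x ÷ gcd x y) ^ (q ∸ 1) ∸ (y ÷ gcd x y) ^ (q ∸ 1))) →
    (ps : List ℕ) → Unique ps →
    All (λ p → Prime p × ¬ (2 ∣ p) × ¬ (p ∣ ((x ÷ gcd x y) * (y ÷ gcd x y))) ×
               ∃ (λ ℓ → IsOrd (x ÷ gcd x y) (y ÷ gcd x y) p ℓ × ℓ ∣ m × q ∣ ℓ)) ps →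
    length ps ≤ k
lemma13 x y z m n 0<y 0<z 0<m 0<n y<x φ-equation _ _ _ gcd[m,n]≡1 q k q-prime q∣m _ q^k∤ ps unique qualifying
  with reduced-pair 0<y y<x
... | 0<g , 0<b , b<a , a⊥b =
  qualifyingPrimes-bound ps 0<g 0<b b<a a⊥b 0<z 0<m reduced-equation gcd[m,n]≡1 q-prime q∣m q^k∤ unique qualifying
  where
  reduced-equation : φ (z * (gcd x y ^ (m ∸ 1) * geomSum m (x ÷ gcd x y) (y ÷ gcd x y)))
                   ≡ z * (gcd x y ^ (n ∸ 1) * geomSum n (x ÷ gcd x y) (y ÷ gcd x y))
  reduced-equation = subst₂ (λ u v → φ (z * u) ≡ z * v)
    ([x^t∸y^t]÷[x∸y]≡g^[t∸1]*geomSum 0<y m {{>-nonZero 0<m}} y<x)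
    ([x^t∸y^t]÷[x∸y]≡g^[t∸1]*geomSum 0<y n {{>-nonZero 0<n}} y<x) φ-equation
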